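{- For all $\Sigma\cup\{\alpha\}\subseteq\mathit{Fm}$, if $\Sigma\vdash_{\mathrm{HIPWK}}\alpha$, then $\Sigma\models_{\mathrm{IPWK}}\alpha$.
   Context: Formulas $\mathit{Fm}$ are built over a countably infinite set $V$ of variables in the language $\mathcal{L}=\{\land,\lor,\longrightarrow,\neg,0,1\}$. $\mathrm{var}(\varphi)$ is the set of variables in $\varphi$. HIPWK is the Hilbert-style logic (derivations from hypotheses $\Sigma$ as finite sequences of axiom instances, hypotheses, and rule applications) with axiom schemes (A1) $\alpha\longrightarrow(\beta\longrightarrow\alpha)$; (A2) $(\alpha\longrightarrow(\beta\longrightarrow\gamma))\longrightarrow((\alpha\longrightarrow\beta)\longrightarrow(\alpha\longrightarrow\gamma))$; (A3) $\alpha\longrightarrow(\beta\longrightarrow(\alpha\land\beta))$; (A4) $\alpha\land\beta\longrightarrow\alpha$; (A5) $\alpha\land\beta\longrightarrow\beta$; (A6) $\alpha\longrightarrow\alpha\lor\beta$; (A7) $\beta\longrightarrow\alpha\lor\beta$; (A8) $(\alpha\longrightarrow\gamma)\longrightarrow((\beta\longrightarrow\gamma)\longrightarrow(\alpha\lor\beta\longrightarrow\gamma))$; (A9) $(\alpha\longrightarrow\beta)\longrightarrow((\alpha\longrightarrow\neg\beta)\longrightarrow\neg\alpha)$; (A10) $0\longrightarrow\alpha$, and the single rule $\frac{\alpha,\ \alpha\longrightarrow\beta}{\beta}$ provided $\mathrm{var}(\alpha)\subseteq\mathrm{var}(\beta)$. For a Heyting algebra $\mathbf{H}$ (as an $\mathcal{L}$-algebra,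 universe $H$), $\mathbf{H}^\#$ has universe $H\cup\{\omega\}$ ($\omega\notin H$), constants as in $\mathbf{H}$, and each operation of arity $\ge1$ agrees with $\mathbf{H}$ on arguments in $H$ and returns $\omega$ if some argument is $\omega$. $\Sigma\models_{\mathrm{IPWK}}\alpha$ iff for every Heyting algebra $\mathbf{H}$ and every homomorphism $v^\#:\mathbf{Fm}\to\mathbf{H}^\#$, $v^\#[\Sigma]\subseteq\{1,\omega\}$ implies $v^\#(\alpha)\in\{1,\omega\}$. -}

module Defs where

open import Level using (Level; _⊔_; Lift)
open import Data.Unit using (⊤)
open import Data.Empty using (⊥)
open import Data.Nat using (ℕ)
open import Data.List using (List; []; _∷_; _++_)
open import Data.List.Membership.Propositional using (_∈_)
open import Data.List.Relation.Binary.Subset.Propositional using (_⊆_)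
open import Data.Product using (Σ; ∃; ∃-syntax; _×_; _,_)
open import Data.Sum using (_⊎_)
open import Relation.Binary.PropositionalEquality using (_≡_)
open import Relation.Binary.Lattice.Bundles using (HeytingAlgebra)

infixr 5 _⇒_
infixr 6 _∨_
infixr 7 _∧_

data Fm : Set where
  var  : ℕ → Fm
  _∧_  : Fm → Fm → Fm
  _∨_  : Fm → Fm → Fm
  _⇒_  : Fm → Fm → Fm
  ¬_   : Fm → Fm
  𝟘    : Fm
  𝟙    : Fm

vars : Fm → List ℕ
vars (var x) = x ∷ []
vars (φ ∧ ψ) = vars φ ++ vars ψ
vars (φ ∨ ψ) = vars φ ++ vars ψ
vars (φ ⇒ ψ) = vars φ ++ vars ψ
vars (¬ φ)   = vars φ
vars 𝟘       = []
vars 𝟙       = []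

FmSet : Set₁
FmSet = Fm → Set

data Axiom : Fm → Set where
  A1  : ∀ α β → Axiom (α ⇒ (β ⇒ α))
  A2  : ∀ α β γ → Axiom ((α ⇒ (β ⇒ γ)) ⇒ ((α ⇒ β) ⇒ (α ⇒ γ)))
  A3  : ∀ α β → Axiom (α ⇒ (β ⇒ (α ∧ β)))
  A4  : ∀ α β → Axiom ((α ∧ β) ⇒ α)
  A5  : ∀ α β → Axiom ((α ∧ β) ⇒ β)
  A6  : ∀ α β → Axiom (α ⇒ (α ∨ β))
  A7  : ∀ α β → Axiom (β ⇒ (α ∨ β))
  A8  : ∀ α β γ → Axiom ((α ⇒ γ) ⇒ ((β ⇒ γ) ⇒ ((α ∨ β) ⇒ γ)))
  A9  : ∀ α β → Axiom ((α ⇒ β) ⇒ ((α ⇒ ¬ β) ⇒ ¬ α))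
  A10 : ∀ α → Axiom (𝟘 ⇒ α)

Justified : FmSet → List Fm → Fm → Set
Justified Σ' prev φ =
  Axiom φ ⊎ Σ' φ ⊎
  (∃[ α ] (α ∈ prev × (α ⇒ φ) ∈ prev × vars α ⊆ vars φ))

-- A derivation from Σ, stored in reverse order (head = last formula):
-- every formula is justified by the formulas preceding it.
data IsDerivation (Σ' : FmSet) : List Fm → Set where
  []  : IsDerivation Σ' []
  _∷_ : ∀ {φ prev} → Justified Σ' prev φ → IsDerivation Σ' prev →
        IsDerivation Σ' (φ ∷ prev)

_⊢_ : FmSet → Fm → Set
Σ' ⊢ α = ∃[ prev ] IsDerivation Σ' (α ∷ prev)

data Ext {c} (A : Set c) : Set c where
  ι : A → Ext A
  ω : Ext A

module Sharp {c ℓ₁ ℓ₂} (H : HeytingAlgebra c ℓ₁ ℓ₂) where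
  private module H = HeytingAlgebra H
  open H using (Carrier)

  _≈#_ : Ext Carrier → Ext Carrier → Set ℓ₁
  ι a ≈# ι b = a H.≈ b
  ω   ≈# ω   = Lift ℓ₁ ⊤
  _   ≈# _   = Lift ℓ₁ ⊥

  lift₂ : (Carrier → Carrier → Carrier) → Ext Carrier → Ext Carrier → Ext Carrier
  lift₂ f (ι a) (ι b) = ι (f a b)
  lift₂ f _     _     = ω

  lift₁ : (Carrier → Carrier) → Ext Carrier → Ext Carrier
  lift₁ f (ι a) = ι (f a)
  lift₁ f ω     = ω

  negH : Carrier → Carrier
  negH a = a H.⇨ H.⊥

  _∧#_ _∨#_ _⇒#_ : Ext Carrier → Ext Carrier → Ext Carrier
  _∧#_ = lift₂ H._∧_
  _∨#_ = lift₂ H._∨_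
  _⇒#_ = lift₂ H._⇨_

  ¬#_ : Ext Carrier → Ext Carrier
  ¬#_ = lift₁ negH

  𝟘# 𝟙# : Ext Carrier
  𝟘# = ι H.⊥
  𝟙# = ι H.⊤

  record IsHom (h : Fm → Ext Carrier) : Set (c ⊔ ℓ₁) where
    field
      hom-∧ : ∀ φ ψ → h (φ ∧ ψ) ≈# (h φ ∧# h ψ)
      hom-∨ : ∀ φ ψ → h (φ ∨ ψ) ≈# (h φ ∨# h ψ)
      hom-⇒ : ∀ φ ψ → h (φ ⇒ ψ) ≈# (h φ ⇒# h ψ)
      hom-¬ : ∀ φ → h (¬ φ) ≈# (¬# h φ)
      hom-𝟘 : h 𝟘 ≈# 𝟘#
      hom-𝟙 : h 𝟙 ≈# 𝟙#

  Designated : Ext Carrier → Set ℓ₁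
  Designated x = x ≈# 𝟙# ⊎ x ≈# ω

_⊨[_,_,_]_ : FmSet → (c ℓ₁ ℓ₂ : Level) → Fm → Set _
Σ' ⊨[ c , ℓ₁ , ℓ₂ ] α =
  (H : HeytingAlgebra c ℓ₁ ℓ₂) → let open Sharp H in
  (h : Fm → Ext (HeytingAlgebra.Carrier H)) → IsHom h →
  (∀ φ → Σ' φ → Designated (h φ)) → Designated (h α)

-- A homomorphism h : Fm → H# sends a formula to ω exactly when it sends one of its
-- variables to ω; otherwise h agrees with the ordinary Heyting valuation of the formula
-- determined by the values of its variables.  Axioms are Heyting tautologies, so they
-- are designated; and since var(α) ⊆ var(β), whenever the conclusion β of the restricted
-- modus ponens has a value in H so do α and α → β, and the rule is sound in H.
module Submission where

open import Defs
open import Level using (Level; lift)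
open import Data.Unit using (⊤; tt)
open import Data.Empty using (⊥)
open import Data.Nat using (ℕ)
open import Data.List using (List; _∷_; _++_)
open import Data.List.Membership.Propositional using (_∈_)
open import Data.List.Relation.Binary.Subset.Propositional using (_⊆_)
open import Data.List.Membership.Propositional.Properties using (∈-++⁺ˡ; ∈-++⁺ʳ; ∈-++⁻)
open import Data.List.Relation.Unary.Any using (here)
open import Data.List.Relation.Unary.All as All using (All; []; _∷_)
open import Data.Product using (_×_; _,_)
open import Data.Sum using (inj₁; inj₂; [_,_]′)
open import Function using (_∘_)
open import Relation.Binary.PropositionalEquality using (refl)
open import Relation.Binary.Lattice.Bundles using (HeytingAlgebra)
import Relation.Binary.Lattice.Properties.HeytingAlgebra as HeytingProperties
import Relation.Binary.Lattice.Properties.MeetSemilattice as MeetProperties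
import Relation.Binary.Lattice.Properties.JoinSemilattice as JoinProperties

IsDefined : ∀ {c} {A : Set c} → Ext A → Set
IsDefined (ι _) = ⊤
IsDefined ω     = ⊥

fromExt : ∀ {c} {A : Set c} → A → Ext A → A
fromExt _ (ι a) = a
fromExt d ω     = d

module HeytingSemantics {c ℓ₁ ℓ₂} (H : HeytingAlgebra c ℓ₁ ℓ₂) where
  open HeytingAlgebra H renaming (_∧_ to _⊓_; _∨_ to _⊔_; ⊤ to ⊤ᴴ; ⊥ to ⊥ᴴ; refl to ≤-refl)

  ⟦_⟧ : Fm → (ℕ → Carrier) → Carrier
  ⟦ var x ⟧ ρ = ρ x
  ⟦ φ ∧ ψ ⟧ ρ = ⟦ φ ⟧ ρ ⊓ ⟦ ψ ⟧ ρ
  ⟦ φ ∨ ψ ⟧ ρ = ⟦ φ ⟧ ρ ⊔ ⟦ ψ ⟧ ρ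
  ⟦ φ ⇒ ψ ⟧ ρ = ⟦ φ ⟧ ρ ⇨ ⟦ ψ ⟧ ρ
  ⟦ ¬ φ ⟧ ρ   = ⟦ φ ⟧ ρ ⇨ ⊥ᴴ
  ⟦ 𝟘 ⟧ ρ     = ⊥ᴴ
  ⟦ 𝟙 ⟧ ρ     = ⊤ᴴ

  ⊤≤⇒≈⊤ : ∀ {a} → ⊤ᴴ ≤ a → a ≈ ⊤ᴴ
  ⊤≤⇒≈⊤ = antisym (maximum _)

  ⇨-elim : ∀ {w x y} → w ≤ (x ⇨ y) → w ≤ x → w ≤ y
  ⇨-elim w≤x⇨y w≤x = trans (∧-greatest ≤-refl w≤x) (transpose-∧ w≤x⇨y)

  ∨-elim : ∀ {w x y z} → (w ⊓ x) ≤ z → (w ⊓ y) ≤ z → (w ⊓ (x ⊔ y)) ≤ z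
  ∨-elim wx≤z wy≤z =
    trans (∧-greatest (x∧y≤y _ _) (x∧y≤x _ _))
          (transpose-∧ (∨-least (transpose-⇨ (trans swap wx≤z))
                                (transpose-⇨ (trans swap wy≤z))))
    where
    swap : ∀ {a b} → (b ⊓ a) ≤ (a ⊓ b)
    swap = ∧-greatest (x∧y≤y _ _) (x∧y≤x _ _)

  ⇨-mp-⊤ : ∀ {a b} → a ≈ ⊤ᴴ → (a ⇨ b) ≈ ⊤ᴴ → b ≈ ⊤ᴴ
  ⇨-mp-⊤ a≈⊤ a⇨b≈⊤ = ⊤≤⇒≈⊤ (⇨-elim (reflexive (Eq.sym a⇨b≈⊤)) (reflexive (Eq.sym a≈⊤)))

  -- Natural deduction inside H: a context is the left-nested meet of its assumptions,
  -- so the last assumption is x∧y≤y and earlier ones are reached through x∧y≤x.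
  axiom-valid : ∀ {φ} → Axiom φ → ∀ ρ → ⟦ φ ⟧ ρ ≈ ⊤ᴴ
  axiom-valid ax ρ = ⊤≤⇒≈⊤ (⊤≤ ax)
    where
    π₁ : ∀ {x y} → (x ⊓ y) ≤ x
    π₁ = x∧y≤x _ _
    π₂ : ∀ {x y} → (x ⊓ y) ≤ y
    π₂ = x∧y≤y _ _

    ⊤≤ : ∀ {φ} → Axiom φ → ⊤ᴴ ≤ ⟦ φ ⟧ ρ
    ⊤≤ (A1 α β)   = transpose-⇨ (transpose-⇨ (trans π₁ π₂))
    ⊤≤ (A2 α β γ) = transpose-⇨ (transpose-⇨ (transpose-⇨
      (⇨-elim (⇨-elim (trans π₁ (trans π₁ π₂)) π₂) (⇨-elim (trans π₁ π₂) π₂))))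
    ⊤≤ (A3 α β)   = transpose-⇨ (transpose-⇨ (∧-greatest (trans π₁ π₂) π₂))
    ⊤≤ (A4 α β)   = transpose-⇨ (trans π₂ π₁)
    ⊤≤ (A5 α β)   = transpose-⇨ (trans π₂ π₂)
    ⊤≤ (A6 α β)   = transpose-⇨ (trans π₂ (x≤x∨y _ _))
    ⊤≤ (A7 α β)   = transpose-⇨ (trans π₂ (y≤x∨y _ _))
    ⊤≤ (A8 α β γ) = transpose-⇨ (transpose-⇨ (transpose-⇨
      (∨-elim (⇨-elim (trans π₁ (trans π₁ π₂)) π₂) (⇨-elim (trans π₁ π₂) π₂))))
    ⊤≤ (A9 α β)   = transpose-⇨ (transpose-⇨ (transpose-⇨
      (⇨-elim (⇨-elim (trans π₁ π₂) π₂) (⇨-elim (trans π₁ (trans π₁ π₂)) π₂))))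
    ⊤≤ (A10 α)    = transpose-⇨ (trans π₂ (minimum _))

module SharpProperties {c ℓ₁ ℓ₂} (H : HeytingAlgebra c ℓ₁ ℓ₂) where
  open HeytingAlgebra H using (Carrier; _≈_; module Eq) renaming (⊤ to ⊤ᴴ)
  open Sharp H

  ≈#-ι-fromExt : ∀ {d} x → IsDefined x → x ≈# ι (fromExt d x)
  ≈#-ι-fromExt (ι _) _ = Eq.refl

  ≈#-lift₂-ι : ∀ {f a b} z x y → (∀ {a a' b b'} → a ≈ a' → b ≈ b' → f a b ≈ f a' b') →
               z ≈# lift₂ f x y → x ≈# ι a → y ≈# ι b → z ≈# ι (f a b)
  ≈#-lift₂-ι (ι _) (ι _) (ι _) f-cong z≈ x≈a y≈b = Eq.trans z≈ (f-cong x≈a y≈b)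

  ≈#-lift₁-ι : ∀ {f a} z x → (∀ {a a'} → a ≈ a' → f a ≈ f a') →
               z ≈# lift₁ f x → x ≈# ι a → z ≈# ι (f a)
  ≈#-lift₁-ι (ι _) (ι _) f-cong z≈ x≈a = Eq.trans z≈ (f-cong x≈a)

  ≈#-lift₂-defined⁻ : ∀ {f} z x y → z ≈# lift₂ f x y → IsDefined z → IsDefined x × IsDefined y
  ≈#-lift₂-defined⁻ (ι _) (ι _) (ι _) _ _ = tt , tt

  ≈#-lift₁-defined⁻ : ∀ {f} z x → z ≈# lift₁ f x → IsDefined z → IsDefined x
  ≈#-lift₁-defined⁻ (ι _) (ι _) _ _ = tt

  ≈#-ι-designated⁻ : ∀ {a} x → x ≈# ι a → Designated x → a ≈ ⊤ᴴ
  ≈#-ι-designated⁻ (ι _) b≈a (inj₁ b≈⊤) = Eq.trans (Eq.sym b≈a) b≈⊤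

  ≈#-ι-designated : ∀ {a} x → x ≈# ι a → a ≈ ⊤ᴴ → Designated x
  ≈#-ι-designated (ι _) b≈a a≈⊤ = inj₁ (Eq.trans b≈a a≈⊤)

  designated-if-designated-when-defined : ∀ x → (IsDefined x → Designated x) → Designated x
  designated-if-designated-when-defined (ι _) designated = designated tt
  designated-if-designated-when-defined ω     _          = inj₂ (lift tt)

module HomProperties {c ℓ₁ ℓ₂} (H : HeytingAlgebra c ℓ₁ ℓ₂)
                     (h : Fm → Ext (HeytingAlgebra.Carrier H)) (hom : Sharp.IsHom H h) where
  open HeytingAlgebra H using (Carrier; _≈_; module Eq; meetSemilattice; joinSemilattice)
    renaming (⊥ to ⊥ᴴ)
  open HeytingProperties H using (⇨-cong)
  open MeetProperties meetSemilattice using (∧-cong)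
  open JoinProperties joinSemilattice using (∨-cong)
  open Sharp H
  open Sharp.IsHom hom
  open HeytingSemantics H using (⟦_⟧; axiom-valid; ⇨-mp-⊤)
  open SharpProperties H

  Defined : List ℕ → Set
  Defined xs = ∀ {x} → x ∈ xs → IsDefined (h (var x))

  Defined-++ : ∀ {xs ys} → Defined xs → Defined ys → Defined (xs ++ ys)
  Defined-++ {xs} xs-defined ys-defined x∈ = [ xs-defined , ys-defined ]′ (∈-++⁻ xs x∈)

  -- ⊥ᴴ is a junk value for the variables sent to ω; h≈⟦⟧ reads ρ only on defined ones.
  ρ : ℕ → Carrier
  ρ x = fromExt ⊥ᴴ (h (var x))

  h≈⟦⟧ : ∀ φ → Defined (vars φ) → h φ ≈# ι (⟦ φ ⟧ ρ)
  h≈⟦⟧ (var x) defined = ≈#-ι-fromExt (h (var x)) (defined (here refl))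
  h≈⟦⟧ (φ ∧ ψ) defined =
    ≈#-lift₂-ι (h (φ ∧ ψ)) (h φ) (h ψ) ∧-cong (hom-∧ φ ψ)
      (h≈⟦⟧ φ (defined ∘ ∈-++⁺ˡ)) (h≈⟦⟧ ψ (defined ∘ ∈-++⁺ʳ (vars φ)))
  h≈⟦⟧ (φ ∨ ψ) defined =
    ≈#-lift₂-ι (h (φ ∨ ψ)) (h φ) (h ψ) ∨-cong (hom-∨ φ ψ)
      (h≈⟦⟧ φ (defined ∘ ∈-++⁺ˡ)) (h≈⟦⟧ ψ (defined ∘ ∈-++⁺ʳ (vars φ)))
  h≈⟦⟧ (φ ⇒ ψ) defined =
    ≈#-lift₂-ι (h (φ ⇒ ψ)) (h φ) (h ψ) ⇨-cong (hom-⇒ φ ψ)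
      (h≈⟦⟧ φ (defined ∘ ∈-++⁺ˡ)) (h≈⟦⟧ ψ (defined ∘ ∈-++⁺ʳ (vars φ)))
  h≈⟦⟧ (¬ φ)   defined = ≈#-lift₁-ι (h (¬ φ)) (h φ) (λ a≈a' → ⇨-cong a≈a' Eq.refl)
    (hom-¬ φ) (h≈⟦⟧ φ defined)
  h≈⟦⟧ 𝟘       _       = hom-𝟘
  h≈⟦⟧ 𝟙       _       = hom-𝟙

  vars-defined : ∀ φ → IsDefined (h φ) → Defined (vars φ)
  vars-defined (var x) defined (here refl) = defined
  vars-defined (φ ∧ ψ) defined
    with ≈#-lift₂-defined⁻ (h (φ ∧ ψ)) (h φ) (h ψ) (hom-∧ φ ψ) defined
  ... | φ-defined , ψ-defined = Defined-++ (vars-defined φ φ-defined) (vars-defined ψ ψ-defined)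
  vars-defined (φ ∨ ψ) defined
    with ≈#-lift₂-defined⁻ (h (φ ∨ ψ)) (h φ) (h ψ) (hom-∨ φ ψ) defined
  ... | φ-defined , ψ-defined = Defined-++ (vars-defined φ φ-defined) (vars-defined ψ ψ-defined)
  vars-defined (φ ⇒ ψ) defined
    with ≈#-lift₂-defined⁻ (h (φ ⇒ ψ)) (h φ) (h ψ) (hom-⇒ φ ψ) defined
  ... | φ-defined , ψ-defined = Defined-++ (vars-defined φ φ-defined) (vars-defined ψ ψ-defined)
  vars-defined (¬ φ)   defined =
    vars-defined φ (≈#-lift₁-defined⁻ (h (¬ φ)) (h φ) (hom-¬ φ) defined)

  h≈⟦⟧-if-defined : ∀ φ → IsDefined (h φ) → h φ ≈# ι (⟦ φ ⟧ ρ)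
  h≈⟦⟧-if-defined φ = h≈⟦⟧ φ ∘ vars-defined φ

  axiom-designated : ∀ {φ} → Axiom φ → Designated (h φ)
  axiom-designated {φ} ax = designated-if-designated-when-defined (h φ) λ defined →
    ≈#-ι-designated (h φ) (h≈⟦⟧-if-defined φ defined) (axiom-valid ax ρ)

  mp-designated : ∀ {α β} → vars α ⊆ vars β →
                  Designated (h α) → Designated (h (α ⇒ β)) → Designated (h β)
  mp-designated {α} {β} α⊆β α-designated α⇒β-designated =
    designated-if-designated-when-defined (h β) λ β-defined →
      let β-vars : Defined (vars β)
          β-vars  = vars-defined β β-defined
          α-vars : Defined (vars α)
          α-vars  = β-vars ∘ α⊆β
          α⇒β-vars : Defined (vars (α ⇒ β))
          α⇒β-vars = Defined-++ α-vars β-vars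
          ⟦α⟧≈⊤   = ≈#-ι-designated⁻ (h α) (h≈⟦⟧ α α-vars) α-designated
          ⟦α⇒β⟧≈⊤ = ≈#-ι-designated⁻ (h (α ⇒ β)) (h≈⟦⟧ (α ⇒ β) α⇒β-vars) α⇒β-designated
      in ≈#-ι-designated (h β) (h≈⟦⟧ β β-vars) (⇨-mp-⊤ ⟦α⟧≈⊤ ⟦α⇒β⟧≈⊤)

  derivation-designated : ∀ {Σ' : FmSet} → (∀ φ → Σ' φ → Designated (h φ)) →
                          ∀ {l} → IsDerivation Σ' l → All (Designated ∘ h) l
  derivation-designated hyp []          = []
  derivation-designated {Σ'} hyp {φ ∷ prev} (j ∷ d) = justified j ∷ earlier
    where
    earlier : All (Designated ∘ h) prev
    earlier = derivation-designated hyp d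

    justified : Justified Σ' prev φ → Designated (h φ)
    justified (inj₁ ax)                            = axiom-designated ax
    justified (inj₂ (inj₁ φ∈Σ))                    = hyp φ φ∈Σ
    justified (inj₂ (inj₂ (α , α∈ , α⇒φ∈ , α⊆φ))) =
      mp-designated α⊆φ (All.lookup earlier α∈) (All.lookup earlier α⇒φ∈)

theorem4p11 : ∀ {c ℓ₁ ℓ₂ : Level} (Σ' : FmSet) (α : Fm) →
    Σ' ⊢ α → Σ' ⊨[ c , ℓ₁ , ℓ₂ ] α
theorem4p11 Σ' α (_ , derivation) H h hom hyp
  with HomProperties.derivation-designated H h hom hyp derivation
... | α-designated ∷ _ = α-designated
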